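{- Let $G$ be a connected graph of order $n\geqslant 3$ which is not a cycle. Then for every natural number $k$: (i) $|\mathrm{Aut}(G^{\frac{1}{k}})|=|\mathrm{Aut}(G)|$; (ii) $D(G^{\frac{1}{k}})\leqslant D(G)$.
   Context: Graphs are finite and simple. The $k$-subdivision $G^{\frac{1}{k}}$ is obtained by replacing each edge $uv$ of $G$ by a path of length $k$ between $u$ and $v$ with $k-1$ new internal vertices. The distinguishing number $D(H)$ is the least $d$ such that some labeling $V(H)\to\{1,\dots,d\}$ is preserved by no non-trivial automorphism of $H$. -}

module Defs where

open import Data.Nat using (ℕ; zero; suc; _≤_; _≡ᵇ_; _<ᵇ_; NonZero; pred)
open import Data.Bool using (Bool; true; false; _∧_; _∨_)
open import Data.Bool.Properties using (∧-zeroʳ)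
open import Data.Fin using (Fin; toℕ; splitAt; remQuot; _≟_)
open import Data.Fin.Properties using (all?; any?)

open import Data.Sum using (_⊎_; inj₁; inj₂)
open import Data.Product using (_×_; _,_; proj₁; proj₂; ∃)
open import Data.List using (List; []; _∷_; length; lookup; allFin; cartesianProduct; filterᵇ; filter; map; concatMap)
open import Relation.Binary.PropositionalEquality using (_≡_; refl; _≢_)
open import Relation.Nullary using (Dec; yes; no; ¬_)
open import Relation.Nullary.Decidable using (⌊_⌋; _×-dec_; _→-dec_)
import Data.Bool.Properties as B
import Data.Vec.Functional as VF

record Graph : Set where
  field
    order  : ℕ
    adj    : Fin order → Fin order → Bool
    sym    : ∀ u v → adj u v ≡ adj v u
    irrefl : ∀ v → adj v v ≡ false
open Graph public

V : Graph → Set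
V G = Fin (order G)

data Reach (G : Graph) : V G → V G → Set where
  here : ∀ {u} → Reach G u u
  step : ∀ {u v w} → adj G u v ≡ true → Reach G v w → Reach G u w

Connected : Graph → Set
Connected G = ∀ u v → Reach G u v

record IsIso (G H : Graph) (f : V G → V H) : Set where
  field
    injective  : ∀ x y → f x ≡ f y → x ≡ y
    surjective : ∀ y → ∃ λ x → f x ≡ y
    preserves  : ∀ u v → adj H (f u) (f v) ≡ adj G u v

IsAutomorphism : (G : Graph) → (V G → V G) → Set
IsAutomorphism G f = IsIso G G f

-- The cycle C_n on Fin n (vertices i and i+1 adjacent, and 0 adjacent to n-1);
-- this is a simple graph (the cycle C_n) whenever n ≥ 3.
cycAdjD : (n : ℕ) → Fin n → Fin n → Bool
cycAdjD n i j = (suc (toℕ i) ≡ᵇ toℕ j) ∨ ((toℕ i ≡ᵇ 0) ∧ (suc (toℕ j) ≡ᵇ n))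

IsCycle : Graph → Set
IsCycle G = (3 ≤ order G) × ∃ λ (σ : Fin (order G) → V G) →
  (∀ x y → σ x ≡ σ y → x ≡ y) ×
  (∀ u v → adj G (σ u) (σ v) ≡ (cycAdjD (order G) u v ∨ cycAdjD (order G) v u))

-- Counting automorphisms: |Aut(G)| is the number of functions
-- V G → V G (enumerated exhaustively, each exactly once) that are automorphisms.

allFuns : (n m : ℕ) → List (Fin n → Fin m)
allFuns zero    m = (λ ()) ∷ []
allFuns (suc n) m = concatMap (λ x → map (λ f → x VF.∷ f) (allFuns n m)) (allFin m)

isAutomorphism? : (G : Graph) → (f : V G → V G) → Dec (IsAutomorphism G f)
isAutomorphism? G f with
  all? (λ x → all? (λ y → (f x ≟ f y) →-dec (x ≟ y)))
  | all? (λ y → any? (λ x → f x ≟ y))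
  | all? (λ u → all? (λ v → adj G (f u) (f v) B.≟ adj G u v))
... | yes i | yes s | yes p = yes (record { injective = i ; surjective = s ; preserves = p })
... | no ¬i | _ | _ = no (λ a → ¬i (IsIso.injective a))
... | yes _ | no ¬s | _ = no (λ a → ¬s (IsIso.surjective a))
... | yes _ | yes _ | no ¬p = no (λ a → ¬p (IsIso.preserves a))

∣Aut∣ : Graph → ℕ
∣Aut∣ G = length (filter (isAutomorphism? G) (allFuns (order G) (order G)))

IsDistinguishing : (H : Graph) (d : ℕ) → (V H → Fin d) → Set
IsDistinguishing H d c =
  ∀ f → IsAutomorphism H f → (∀ v → c (f v) ≡ c v) → ∀ v → f v ≡ v

HasDistinguishingLabeling : Graph → ℕ → Set
HasDistinguishingLabeling H d = ∃ λ (c : V H → Fin d) → IsDistinguishing H d c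

IsDistinguishingNumber : Graph → ℕ → Set
IsDistinguishingNumber H d =
  HasDistinguishingLabeling H d × (∀ d′ → HasDistinguishingLabeling H d′ → d ≤ d′)

edges : (G : Graph) → List (V G × V G)
edges G = filterᵇ (λ p → (toℕ (proj₁ p) <ᵇ toℕ (proj₂ p)) ∧ adj G (proj₁ p) (proj₂ p))
                  (cartesianProduct (allFin (order G)) (allFin (order G)))

numEdges : Graph → ℕ
numEdges G = length (edges G)

edge : (G : Graph) → Fin (numEdges G) → V G × V G
edge G = lookup (edges G)

-- With k = suc j, the subdivision has vertices V G ⊎ (E × Fin j): the original
-- vertices and, for each edge e = (u , v) (u < v), internal vertices
-- (e , 0) … (e , j - 1) forming the path u – (e,0) – … – (e,j-1) – v.
module _ (G : Graph) (j : ℕ) where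
  private
    m = numEdges G
    _==_ : ∀ {n} → Fin n → Fin n → Bool
    a == b = ⌊ a ≟ b ⌋

  SubV : Set
  SubV = V G ⊎ (Fin m × Fin j)

  -- one direction of each edge of the subdivision
  R : SubV → SubV → Bool
  R (inj₁ a) (inj₁ b) = (j ≡ᵇ 0) ∧ adj G a b
  R (inj₁ a) (inj₂ (e , i)) =
    ((a == proj₁ (edge G e)) ∧ (toℕ i ≡ᵇ 0)) ∨ ((a == proj₂ (edge G e)) ∧ (suc (toℕ i) ≡ᵇ j))
  R (inj₂ _) (inj₁ _) = false
  R (inj₂ (e , i)) (inj₂ (e′ , i′)) = (e == e′) ∧ (suc (toℕ i) ≡ᵇ toℕ i′)

  private
    suc≢ᵇ : ∀ x → (suc x ≡ᵇ x) ≡ false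
    suc≢ᵇ zero = refl
    suc≢ᵇ (suc x) = suc≢ᵇ x

  R-irrefl : ∀ x → R x x ≡ false
  R-irrefl (inj₁ a) rewrite irrefl G a = ∧-zeroʳ (j ≡ᵇ 0)
  R-irrefl (inj₂ (e , i)) rewrite suc≢ᵇ (toℕ i) = ∧-zeroʳ (e == e)

  subOrder : ℕ
  subOrder = order G Data.Nat.+ m Data.Nat.* j

  decode : Fin subOrder → SubV
  decode x with splitAt (order G) x
  ... | inj₁ a = inj₁ a
  ... | inj₂ y = inj₂ (remQuot j y)

  subAdj : Fin subOrder → Fin subOrder → Bool
  subAdj x y = R (decode x) (decode y) ∨ R (decode y) (decode x)

  subSym : ∀ x y → subAdj x y ≡ subAdj y x
  subSym x y = B.∨-comm (R (decode x) (decode y)) (R (decode y) (decode x))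

  subIrrefl : ∀ x → subAdj x x ≡ false
  subIrrefl x rewrite R-irrefl (decode x) = refl

  subdivisionSuc : Graph
  subdivisionSuc = record { order = subOrder ; adj = subAdj ; sym = subSym ; irrefl = subIrrefl }

subdivision : Graph → (k : ℕ) → .{{NonZero k}} → Graph
subdivision G k = subdivisionSuc G (pred k)

module Submission where

open import Defs
open import Data.Nat using (ℕ; _≤_; NonZero)
open import Data.Product using (_×_)
open import Relation.Binary.PropositionalEquality using (_≡_)
open import Relation.Nullary using (¬_)

-- Write k = j + 1 and H = G^{1/k}.  Every automorphism g of G lifts to an
-- automorphism Φ g of H which moves the path subdividing an edge uv onto the path
-- subdividing g(u)g(v).  Conversely, an automorphism F of H that maps original
-- vertices to original vertices restricts to an automorphism ψ of G with F = Φ ψ.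
-- The heart of the proof is that every F has this property:
--   * F maps a vertex of G of degree ≥ 3 or ≤ 1 to an original vertex, since an
--     internal vertex of a subdivided edge has exactly two neighbours in H;
--   * if F maps an original vertex u to an original vertex, it maps each path
--     leaving u onto a whole path, hence the neighbours of u to original
--     vertices; by connectivity all of G follows;
--   * a vertex of degree ≠ 2 exists, because a connected graph on ≥ 3 vertices
--     in which every vertex has exactly two neighbours is a cycle.
-- So lifting and restriction are inverse bijections Aut(G) ≅ Aut(H), giving (i);
-- and colouring the internal vertices arbitrarily extends a distinguishing
-- labeling of G to one of H, giving (ii).

open import Data.Nat using (zero; suc; _<_; z≤n; s≤s; _∸_; _≡ᵇ_; _<ᵇ_; _*_)
  renaming (_≟_ to _≟ℕ_; _<?_ to _<?ℕ_)
open import Data.Nat.Properties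
  using (≤-trans; ≤-antisym; ≤-refl; ≤-pred; <-trans; <-irrefl; <-cmp; <⇒≤; n≤1+n; n<1+n; m≤n⇒m≤1+n;
         ≤∧≢⇒<; ≮⇒≥; n≢0⇒n>0; n≤0⇒n≡0; suc-injective; ≡ᵇ⇒≡; ≡⇒≡ᵇ; <ᵇ⇒<; m∸n≤m; +-∸-assoc;
         m∸[m∸n]≡n; ∸-cancelˡ-≡; n∸n≡0; ≤-reflexive)
open import Data.Bool using (Bool; true; false; _∧_; _∨_; not; T; T?)
open import Data.Bool.Properties using (∨-comm)
import Data.Bool as Bool
open import Data.Unit using (tt)
open import Data.Empty using (⊥; ⊥-elim)
open import Data.Fin using (Fin; zero; suc; toℕ; fromℕ<; splitAt; remQuot; combine; _↑ˡ_; _↑ʳ_; _≟_)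
open import Data.Fin.Properties
  using (all?; any?; toℕ-injective; toℕ<n; fromℕ<-toℕ; toℕ-fromℕ<; splitAt⁻¹-↑ˡ; splitAt⁻¹-↑ʳ;
         splitAt-↑ˡ; splitAt-↑ʳ; remQuot-combine; combine-remQuot; pigeonhole; injective⇒≤)
open import Data.Product using (_,_; proj₁; proj₂; ∃; Σ)
open import Data.Sum using (_⊎_; inj₁; inj₂; [_,_]′)
open import Data.List using (List; []; _∷_; length; lookup; map; filter; allFin; cartesianProduct)
open import Data.List.Properties using (length-map; filter-notAll)
open import Data.List.Relation.Unary.Any using (Any; here)
import Data.List.Relation.Unary.Any as Any
import Data.List.Relation.Unary.Any.Properties as AnyP
open import Data.List.Relation.Unary.All using (All; []; _∷_)
import Data.List.Relation.Unary.All as All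
import Data.List.Relation.Unary.All.Properties as AllP
open import Data.List.Relation.Unary.AllPairs using (AllPairs; []; _∷_)
import Data.List.Relation.Unary.AllPairs as AP
import Data.List.Relation.Unary.AllPairs.Properties as APP
import Data.List.Relation.Unary.Unique.Propositional.Properties as UniqueP
open import Data.List.Membership.Propositional using (_∈_)
open import Data.List.Membership.Propositional.Properties
  using (∈-allFin; ∈-lookup; ∈-filter⁺; ∈-filter⁻; ∈-cartesianProduct⁺)
import Data.Vec.Functional as VF
open import Relation.Binary using (tri<; tri≈; tri>)
open import Relation.Binary.PropositionalEquality
  using (refl; trans; cong; cong₂; subst; subst₂; _≗_; _≢_) renaming (sym to ≡sym)
open import Relation.Nullary using (Dec; yes; no)
open import Relation.Nullary.Decidable using (⌊_⌋; toWitness; fromWitness; ¬?; _×-dec_; _⊎-dec_; _→-dec_)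

module AutomorphismCounting where

  -- A list that is duplicate-free up to an equivalence ≈, and all of whose entries
  -- occur in ys up to ≈, is no longer than ys: match the head, delete all of its
  -- ≈-copies from ys, and recurse.
  module DistinctCovered {A : Set} (_≈_ : A → A → Set)
    (≈-sym : ∀ {x y} → x ≈ y → y ≈ x)
    (≈-trans : ∀ {x y z} → x ≈ y → y ≈ z → x ≈ z)
    (_≈?_ : ∀ x y → Dec (x ≈ y)) where

    remove : A → List A → List A
    remove x = filter (λ y → ¬? (x ≈? y))

    remove-keeps : ∀ x z ys → ¬ x ≈ z → Any (z ≈_) ys → Any (z ≈_) (remove x ys)
    remove-keeps x z ys x≉z z∈ys with AnyP.filter⁺ (λ y → ¬? (x ≈? y)) z∈ys
    ... | inj₁ z∈rest = z∈rest
    ... | inj₂ ¬x≉y = ⊥-elim (¬x≉y (λ x≈y → x≉z (≈-trans x≈y (≈-sym (AnyP.lookup-result z∈ys)))))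

    length-≤ : ∀ xs ys → AllPairs (λ u v → ¬ u ≈ v) xs → All (λ x → Any (x ≈_) ys) xs →
               length xs ≤ length ys
    length-≤ [] ys _ _ = z≤n
    length-≤ (x ∷ xs) ys (x≉xs ∷ distinct) (x∈ys ∷ xs⊆ys) =
      ≤-trans (s≤s (length-≤ xs (remove x ys) distinct (All.zipWith keep (x≉xs , xs⊆ys))))
              (filter-notAll (λ y → ¬? (x ≈? y)) ys (Any.map (λ x≈y x≉y → x≉y x≈y) x∈ys))
      where
      keep : ∀ {z} → ¬ x ≈ z × Any (z ≈_) ys → Any (z ≈_) (remove x ys)
      keep {z} (x≉z , z∈ys) = remove-keeps x z ys x≉z z∈ys

  Differ : ∀ {n m} → (Fin n → Fin m) → (Fin n → Fin m) → Set
  Differ f g = ∃ λ i → f i ≢ g i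

  allFuns-complete : ∀ n m (f : Fin n → Fin m) → Any (λ g → g ≗ f) (allFuns n m)
  allFuns-complete zero m f = here (λ ())
  allFuns-complete (suc n) m f =
    AnyP.concatMap⁺ _ (Any.map (λ {x} f0≡x → AnyP.map⁺ (Any.map (λ {g} g≗ → cons-≗ x g f0≡x g≗)
                                                               (allFuns-complete n m (λ i → f (suc i)))))
                                (∈-allFin (f zero)))
    where
    cons-≗ : ∀ x g → f zero ≡ x → g ≗ (λ i → f (suc i)) → (x VF.∷ g) ≗ f
    cons-≗ x g f0≡x g≗ zero = ≡sym f0≡x
    cons-≗ x g f0≡x g≗ (suc i) = g≗ i

  allFuns-distinct : ∀ n m → AllPairs Differ (allFuns n m)
  allFuns-distinct zero m = [] ∷ []
  allFuns-distinct (suc n) m =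
    APP.concat⁺ (AllP.map⁺ (All.tabulate (λ {x} _ → APP.map⁺ (AP.map differ-tail (allFuns-distinct n m)))))
                (APP.map⁺ (AP.map (λ {x} {y} x≢y → differ-head x y x≢y) (APP.tabulate⁺ {f = λ i → i} (λ x≢y → x≢y))))
    where
    differ-tail : ∀ {x} {f g : Fin n → Fin m} → Differ f g → Differ (x VF.∷ f) (x VF.∷ g)
    differ-tail (i , ne) = suc i , ne
    differ-head : ∀ x y → x ≢ y →
      All (λ u → All (Differ u) (map (y VF.∷_) (allFuns n m))) (map (x VF.∷_) (allFuns n m))
    differ-head x y x≢y = AllP.map⁺ (All.tabulate (λ _ → AllP.map⁺ (All.tabulate (λ _ → zero , x≢y))))

  automorphism-resp-≗ : ∀ G {f g : V G → V G} → f ≗ g → IsAutomorphism G f → IsAutomorphism G g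
  automorphism-resp-≗ G {f} {g} f≗g a = record
    { injective = λ x y eq → IsIso.injective a x y (trans (f≗g x) (trans eq (≡sym (f≗g y))))
    ; surjective = λ y → proj₁ (IsIso.surjective a y) , trans (≡sym (f≗g _)) (proj₂ (IsIso.surjective a y))
    ; preserves = λ u v → trans (cong₂ (adj G) (≡sym (f≗g u)) (≡sym (f≗g v))) (IsIso.preserves a u v) }

  record AutCorrespondence (G H : Graph) : Set where
    field
      φ : (V G → V G) → (V H → V H)
      ψ : (V H → V H) → (V G → V G)
      φ-aut : ∀ f → IsAutomorphism G f → IsAutomorphism H (φ f)
      ψ-aut : ∀ g → IsAutomorphism H g → IsAutomorphism G (ψ g)
      ψ-resp : ∀ g g′ → IsAutomorphism H g → IsAutomorphism H g′ → g ≗ g′ → ψ g ≗ ψ g′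
      φ-resp : ∀ f f′ → IsAutomorphism G f → IsAutomorphism G f′ → f ≗ f′ → φ f ≗ φ f′
      ψφ : ∀ f → IsAutomorphism G f → ψ (φ f) ≗ f
      φψ : ∀ g → IsAutomorphism H g → φ (ψ g) ≗ g

  correspondence-sym : ∀ {G H} → AutCorrespondence G H → AutCorrespondence H G
  correspondence-sym c = record
    { φ = ψ ; ψ = φ ; φ-aut = ψ-aut ; ψ-aut = φ-aut ; φ-resp = ψ-resp ; ψ-resp = φ-resp ; ψφ = φψ ; φψ = ψφ }
    where open AutCorrespondence c

  module _ {n : ℕ} where
    open DistinctCovered {Fin n → Fin n} _≗_ (λ p x → ≡sym (p x)) (λ p q x → trans (p x) (q x))
                         (λ f g → all? (λ i → f i ≟ g i)) public

  allPairs-with : ∀ {A : Set} {P : A → Set} (R : A → A → Set) {xs} → All P xs → AllPairs R xs →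
    AllPairs (λ x y → P x × P y × R x y) xs
  allPairs-with R [] [] = []
  allPairs-with R (px ∷ pxs) (r ∷ rs) = All.zipWith (λ (py , rxy) → px , py , rxy) (pxs , r) ∷ allPairs-with R pxs rs

  -- φ maps the distinct automorphisms of G to distinct automorphisms of H
  correspondence-≤ : ∀ {G H} → AutCorrespondence G H → ∣Aut∣ G ≤ ∣Aut∣ H
  correspondence-≤ {G} {H} c = subst (_≤ ∣Aut∣ H) (length-map φ AutG)
    (length-≤ (map φ AutG) AutH
       (APP.map⁺ (AP.map φ-distinct (allPairs-with (λ f g → ¬ f ≗ g) autsG
                   (APP.filter⁺ (isAutomorphism? G) (AP.map differ⇒≉ (allFuns-distinct _ _))))))
       (AllP.map⁺ (All.map (λ {f} af → listed (φ f) (φ-aut f af)) autsG)))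
    where
    open AutCorrespondence c
    AutG : List (V G → V G)
    AutG = filter (isAutomorphism? G) (allFuns (order G) (order G))
    AutH : List (V H → V H)
    AutH = filter (isAutomorphism? H) (allFuns (order H) (order H))
    autsG : All (IsAutomorphism G) AutG
    autsG = AllP.all-filter (isAutomorphism? G) (allFuns (order G) (order G))
    differ⇒≉ : ∀ {f g : V G → V G} → Differ f g → ¬ f ≗ g
    differ⇒≉ (i , ne) e = ne (e i)
    φ-distinct : ∀ {f g} → IsAutomorphism G f × IsAutomorphism G g × (¬ f ≗ g) → ¬ φ f ≗ φ g
    φ-distinct {f} {g} (af , ag , f≉g) φf≗φg =
      f≉g (λ x → trans (≡sym (ψφ f af x)) (trans (ψ-resp (φ f) (φ g) (φ-aut f af) (φ-aut g ag) φf≗φg x) (ψφ g ag x)))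
    listed : ∀ g → IsAutomorphism H g → Any (g ≗_) AutH
    listed g ag with AnyP.filter⁺ (isAutomorphism? H) (allFuns-complete (order H) (order H) g)
                   | AnyP.lookup-result (allFuns-complete (order H) (order H) g)
    ... | inj₁ p | _ = Any.map (λ e x → ≡sym (e x)) p
    ... | inj₂ ¬aut | r = ⊥-elim (¬aut (automorphism-resp-≗ H (λ x → ≡sym (r x)) ag))

  correspondence⇒∣Aut∣≡ : ∀ {G H} → AutCorrespondence G H → ∣Aut∣ H ≡ ∣Aut∣ G
  correspondence⇒∣Aut∣≡ c = ≤-antisym (correspondence-≤ (correspondence-sym c)) (correspondence-≤ c)

module BoolFacts where
  open import Data.Bool.Properties using (T-∨; T-∧; T-≡)
  open import Function.Bundles using (Equivalence)
  open Equivalence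

  T∨ : ∀ {a b} → T (a ∨ b) → T a ⊎ T b
  T∨ = to T-∨

  T∧ : ∀ {a b} → T (a ∧ b) → T a × T b
  T∧ = to T-∧

  ∨ˡ : ∀ {a} b → T a → T (a ∨ b)
  ∨ˡ b t = from T-∨ (inj₁ t)

  ∨ʳ : ∀ a {b} → T b → T (a ∨ b)
  ∨ʳ a t = from T-∨ (inj₂ t)

  ∧-intro : ∀ {a b} → T a → T b → T (a ∧ b)
  ∧-intro ta tb = from T-∧ (ta , tb)

  ≡→T : ∀ {b} → b ≡ true → T b
  ≡→T = from T-≡

  T→≡ : ∀ {b} → T b → b ≡ true
  T→≡ = to T-≡

  true≢false : ¬ true ≡ false
  true≢false ()

  ≟-sound : ∀ {k} {a b : Fin k} → T ⌊ a ≟ b ⌋ → a ≡ b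
  ≟-sound {a = a} {b} = toWitness {a? = a ≟ b}

  ≟-refl : ∀ {k} (a : Fin k) → T ⌊ a ≟ a ⌋
  ≟-refl a = fromWitness {a? = a ≟ a} refl

  bool-iff : ∀ {a b} → (T a → T b) → (T b → T a) → a ≡ b
  bool-iff {true} {true} _ _ = refl
  bool-iff {true} {false} f _ = ⊥-elim (f tt)
  bool-iff {false} {true} _ g = ⊥-elim (g tt)
  bool-iff {false} {false} _ _ = refl

open BoolFacts

lookup-injective : ∀ {A : Set} {xs : List A} → AllPairs (λ x y → ¬ x ≡ y) xs →
                   ∀ i k → lookup xs i ≡ lookup xs k → i ≡ k
lookup-injective (p ∷ ps) zero zero eq = refl
lookup-injective (p ∷ ps) zero (suc k) eq = ⊥-elim (All.lookup p (∈-lookup k) eq)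
lookup-injective (p ∷ ps) (suc i) zero eq = ⊥-elim (All.lookup p (∈-lookup i) (≡sym eq))
lookup-injective (p ∷ ps) (suc i) (suc k) eq = cong suc (lookup-injective ps i k eq)

-- The edge list of G.  An edge e is stored as the pair (endp e false , endp e true)
-- with smaller endpoint first; `endp e d` and `endp e (not d)` are its two
-- endpoints read in direction d.
module Edges (G : Graph) where
  n m : ℕ
  n = order G
  m = numEdges G

  endp : Fin m → Bool → V G
  endp e false = proj₁ (edge G e)
  endp e true = proj₂ (edge G e)

  private
    edgeP : V G × V G → Bool
    edgeP p = (toℕ (proj₁ p) <ᵇ toℕ (proj₂ p)) ∧ adj G (proj₁ p) (proj₂ p)

    edge-prop : ∀ e → T (edgeP (edge G e))
    edge-prop e = proj₂ (∈-filter⁻ (λ p → T? (edgeP p)) {xs = cartesianProduct (allFin n) (allFin n)}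
                                   (∈-lookup {xs = edges G} e))

    edges-distinct : AllPairs (λ x y → ¬ x ≡ y) (edges G)
    edges-distinct = UniqueP.filter⁺ (λ p → T? (edgeP p))
                       (UniqueP.cartesianProduct⁺ (UniqueP.allFin⁺ n) (UniqueP.allFin⁺ n))

    find-edge : ∀ a b → toℕ a < toℕ b → adj G a b ≡ true → Σ (Fin m) λ e → edge G e ≡ (a , b)
    find-edge a b a<b ab = Any.index listed , ≡sym (AnyP.lookup-index listed)
      where
      <⇒T : ∀ x y → x < y → T ((x <ᵇ y) ∧ true)
      <⇒T zero (suc y) _ = tt
      <⇒T (suc x) (suc y) (s≤s x<y) = <⇒T x y x<y
      listed : (a , b) ∈ edges G
      listed = ∈-filter⁺ (λ p → T? (edgeP p)) (∈-cartesianProduct⁺ (∈-allFin a) (∈-allFin b))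
                         (subst (λ z → T ((toℕ a <ᵇ toℕ b) ∧ z)) (≡sym ab) (<⇒T (toℕ a) (toℕ b) a<b))

  endp-< : ∀ e → toℕ (endp e false) < toℕ (endp e true)
  endp-< e = <ᵇ⇒< _ _ (proj₁ (T∧ (edge-prop e)))

  endp-adj : ∀ e → adj G (endp e false) (endp e true) ≡ true
  endp-adj e = T→≡ (proj₂ (T∧ (edge-prop e)))

  endp-adj-dir : ∀ e d → adj G (endp e d) (endp e (not d)) ≡ true
  endp-adj-dir e false = endp-adj e
  endp-adj-dir e true = trans (sym G _ _) (endp-adj e)

  endp-≢ : ∀ e d → ¬ endp e d ≡ endp e (not d)
  endp-≢ e false eq = <-irrefl (cong toℕ eq) (endp-< e)
  endp-≢ e true eq = <-irrefl (cong toℕ (≡sym eq)) (endp-< e)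

  adj⇒edge : ∀ a b → adj G a b ≡ true → Σ (Fin m) λ e → Σ Bool λ d → endp e d ≡ a × endp e (not d) ≡ b
  adj⇒edge a b ab with <-cmp (toℕ a) (toℕ b)
  ... | tri< a<b _ _ = let (e , eq) = find-edge a b a<b ab in e , false , cong proj₁ eq , cong proj₂ eq
  ... | tri≈ _ eq _ with toℕ-injective eq
  ...   | refl = ⊥-elim (true≢false (trans (≡sym ab) (irrefl G a)))
  adj⇒edge a b ab | tri> _ _ b<a =
    let (e , eq) = find-edge b a b<a (trans (sym G b a) ab) in e , true , cong proj₂ eq , cong proj₁ eq

  endp-injective : ∀ e d e′ d′ → endp e d ≡ endp e′ d′ → endp e (not d) ≡ endp e′ (not d′) →
                   e ≡ e′ × d ≡ d′
  endp-injective e false e′ false p q = lookup-injective edges-distinct e e′ (cong₂ _,_ p q) , refl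
  endp-injective e true e′ true p q = lookup-injective edges-distinct e e′ (cong₂ _,_ q p) , refl
  endp-injective e false e′ true p q =
    ⊥-elim (<-irrefl refl (<-trans (endp-< e) (subst₂ _<_ (cong toℕ (≡sym q)) (cong toℕ (≡sym p)) (endp-< e′))))
  endp-injective e true e′ false p q =
    ⊥-elim (<-irrefl refl (<-trans (endp-< e) (subst₂ _<_ (cong toℕ (≡sym p)) (cong toℕ (≡sym q)) (endp-< e′))))

-- The geometry of the subdivision H = G^{1/(j+1)}: each edge e of G becomes a path
-- endp e false = Wf e 0, Wf e 1, …, Wf e (j + 1) = endp e true.
module SubdivisionPaths (G : Graph) (j : ℕ) where
  open Edges G public
  open import Data.Sum.Properties using (inj₁-injective; inj₂-injective)

  SV : Set
  SV = SubV G j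

  adjᴴ : SV → SV → Bool
  adjᴴ x y = R G j x y ∨ R G j y x

  inj₁≢inj₂ : ∀ {a : V G} {x : Fin m × Fin j} → _≡_ {A = SV} (inj₁ a) (inj₂ x) → ⊥
  inj₁≢inj₂ ()

  j∸suc<j : ∀ t → t < j → j ∸ suc t < j
  j∸suc<j t t<j = subst (_≤ j) (+-∸-assoc 1 t<j) (m∸n≤m j t)

  -- Wf e s, for s ≤ j + 1, is the s-th vertex on the subdivided edge e, counted
  -- from endp e false; W e d s counts from endp e d instead.
  -- position t + 1 is internal exactly when t < j
  Wint : Fin m → (t : ℕ) → Dec (t < j) → SV
  Wint e t (yes p) = inj₂ (e , fromℕ< p)
  Wint e t (no _) = inj₁ (endp e true)

  Wf : Fin m → ℕ → SV
  Wf e zero = inj₁ (endp e false)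
  Wf e (suc t) = Wint e t (t <?ℕ j)

  W : Fin m → Bool → ℕ → SV
  W e false s = Wf e s
  W e true s = Wf e (suc j ∸ s)

  W-int : ∀ e (i : Fin j) → Wf e (suc (toℕ i)) ≡ inj₂ (e , i)
  W-int e i with toℕ i <?ℕ j
  ... | yes p = cong (λ z → inj₂ (e , z)) (fromℕ<-toℕ i p)
  ... | no np = ⊥-elim (np (toℕ<n i))

  W-int′ : ∀ e t (p : t < j) → Wf e (suc t) ≡ inj₂ (e , fromℕ< p)
  W-int′ e t p with t <?ℕ j
  ... | yes q = refl
  ... | no np = ⊥-elim (np p)

  W-end : ∀ e → Wf e (suc j) ≡ inj₁ (endp e true)
  W-end e with j <?ℕ j
  ... | yes p = ⊥-elim (<-irrefl refl p)
  ... | no _ = refl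

  W-0 : ∀ e d → W e d 0 ≡ inj₁ (endp e d)
  W-0 e false = refl
  W-0 e true = W-end e

  W-last : ∀ e d → W e d (suc j) ≡ inj₁ (endp e (not d))
  W-last e false = W-end e
  W-last e true rewrite n∸n≡0 j = refl

  W-flip : ∀ e d s → s ≤ suc j → W e (not d) s ≡ W e d (suc j ∸ s)
  W-flip e false s p = refl
  W-flip e true s p = cong (Wf e) (≡sym (m∸[m∸n]≡n p))

  -- Adj x y: x and y are consecutive on some subdivided edge.  It is shown below
  -- to be exactly adjacency in the subdivision (`adjᴴ→Adj`, `Adj→adjᴴ`).
  Step : Fin m → ℕ → SV → SV → Set
  Step e s x y = x ≡ Wf e s × y ≡ Wf e (suc s)

  Adj : SV → SV → Set
  Adj x y = Σ (Fin m) λ e → Σ ℕ λ s → s ≤ j × (Step e s x y ⊎ Step e s y x)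

  Adj-sym : ∀ {x y} → Adj x y → Adj y x
  Adj-sym (e , s , p , inj₁ st) = e , s , p , inj₂ st
  Adj-sym (e , s , p , inj₂ st) = e , s , p , inj₁ st

  W-adj : ∀ e d s → s ≤ j → Adj (W e d s) (W e d (suc s))
  W-adj e false s p = e , s , p , inj₁ (refl , refl)
  W-adj e true s p = e , j ∸ s , m∸n≤m j s , inj₂ (refl , cong (Wf e) (+-∸-assoc 1 p))

  Wf-1-when-j≡0 : ∀ e → j ≡ 0 → Wf e 1 ≡ inj₁ (endp e true)
  Wf-1-when-j≡0 e eq = subst (λ z → Wf e (suc z) ≡ inj₁ (endp e true)) eq (W-end e)

  R→Adj : ∀ x y → T (R G j x y) → Adj x y
  R→Adj (inj₁ a) (inj₁ b) t with T∧ {j ≡ᵇ 0} t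
  ... | t0 , tab with adj⇒edge a b (T→≡ tab) | ≡ᵇ⇒≡ j 0 t0
  ...   | e , false , p , q | j0 =
    e , 0 , z≤n , inj₁ (cong inj₁ (≡sym p) , trans (cong inj₁ (≡sym q)) (≡sym (Wf-1-when-j≡0 e j0)))
  ...   | e , true , p , q | j0 =
    e , 0 , z≤n , inj₂ (cong inj₁ (≡sym q) , trans (cong inj₁ (≡sym p)) (≡sym (Wf-1-when-j≡0 e j0)))
  R→Adj (inj₁ a) (inj₂ (e , i)) t with T∨ t
  ... | inj₁ t1 with T∧ t1
  ...   | ta , ti =
    e , 0 , z≤n ,
    inj₁ (cong inj₁ (≟-sound ta) , ≡sym (subst (λ z → Wf e (suc z) ≡ inj₂ (e , i)) (≡ᵇ⇒≡ (toℕ i) 0 ti) (W-int e i)))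
  R→Adj (inj₁ a) (inj₂ (e , i)) t | inj₂ t2 with T∧ t2
  ...   | ta , ti =
    e , suc (toℕ i) , ≤-reflexive (≡ᵇ⇒≡ (suc (toℕ i)) j ti) ,
    inj₂ (≡sym (W-int e i) ,
          trans (cong inj₁ (≟-sound ta))
                (≡sym (subst (λ z → Wf e (suc z) ≡ inj₁ (endp e true)) (≡sym (≡ᵇ⇒≡ (suc (toℕ i)) j ti)) (W-end e))))
  R→Adj (inj₂ _) (inj₁ _) ()
  R→Adj (inj₂ (e , i)) (inj₂ (e′ , i′)) t with T∧ t
  ... | te , ti with ≟-sound {a = e} {e′} te | ≡ᵇ⇒≡ (suc (toℕ i)) (toℕ i′) ti
  ...   | refl | eq =
    e , suc (toℕ i) , <⇒≤ (subst (_< j) (≡sym eq) (toℕ<n i′)) ,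
    inj₁ (≡sym (W-int e i) , ≡sym (subst (λ z → Wf e (suc z) ≡ inj₂ (e , i′)) (≡sym eq) (W-int e i′)))

  adjᴴ→Adj : ∀ x y → T (adjᴴ x y) → Adj x y
  adjᴴ→Adj x y t with T∨ t
  ... | inj₁ r = R→Adj x y r
  ... | inj₂ r = Adj-sym (R→Adj y x r)

  Wf-step-adjacent : ∀ e s → s ≤ j → T (adjᴴ (Wf e s) (Wf e (suc s)))
  Wf-step-adjacent e zero p with 0 <?ℕ j
  ... | yes q = ∨ˡ _ (∨ˡ _ (∧-intro (≟-refl (endp e false)) (subst (λ z → T (z ≡ᵇ 0)) (≡sym (toℕ-fromℕ< q)) tt)))
  ... | no nq = ∨ˡ _ (∧-intro (≡⇒≡ᵇ _ _ j0) (≡→T (endp-adj e)))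
    where
    j0 : j ≡ 0
    j0 = n≤0⇒n≡0 (≮⇒≥ nq)
  Wf-step-adjacent e (suc t) p with t <?ℕ j
  ... | no nt = ⊥-elim (nt p)
  ... | yes q with suc t <?ℕ j
  ...   | yes q′ =
    ∨ˡ _ (∧-intro (≟-refl e) (≡⇒≡ᵇ _ _ (trans (cong suc (toℕ-fromℕ< q)) (≡sym (toℕ-fromℕ< q′)))))
  ...   | no nq′ =
    ∨ʳ false (∨ʳ _ (∧-intro (≟-refl (endp e true))
                            (≡⇒≡ᵇ _ _ (trans (cong suc (toℕ-fromℕ< q)) (≤-antisym p (≮⇒≥ nq′))))))

  adjᴴ-sym : ∀ x y → adjᴴ x y ≡ adjᴴ y x
  adjᴴ-sym x y = ∨-comm (R G j x y) (R G j y x)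

  Adj→adjᴴ : ∀ x y → Adj x y → T (adjᴴ x y)
  Adj→adjᴴ x y (e , s , p , inj₁ (refl , refl)) = Wf-step-adjacent e s p
  Adj→adjᴴ x y (e , s , p , inj₂ (refl , refl)) = subst T (adjᴴ-sym (Wf e s) (Wf e (suc s))) (Wf-step-adjacent e s p)

  Wf-interior-index : ∀ e s e″ i → Wf e s ≡ inj₂ (e″ , i) → e ≡ e″ × s ≡ suc (toℕ i)
  Wf-interior-index e zero e″ i ()
  Wf-interior-index e (suc t) e″ i eq with t <?ℕ j
  ... | no _ = ⊥-elim (inj₁≢inj₂ eq)
  ... | yes p with inj₂-injective eq
  ...   | refl = refl , cong suc (≡sym (toℕ-fromℕ< p))

  Wf-original-index : ∀ e t a → t ≤ j → Wf e (suc t) ≡ inj₁ a → t ≡ j × a ≡ endp e true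
  Wf-original-index e t a t≤j eq with t <?ℕ j
  ... | yes p = ⊥-elim (inj₁≢inj₂ (≡sym eq))
  ... | no np = ≤-antisym t≤j (≮⇒≥ np) , ≡sym (inj₁-injective eq)

  W-internal : ∀ e d t → t < j → Σ (Fin j) λ i → W e d (suc t) ≡ inj₂ (e , i)
  W-internal e false t p = fromℕ< p , W-int′ e t p
  W-internal e true t p = fromℕ< (j∸suc<j t p) , trans (cong (Wf e) (+-∸-assoc 1 p)) (W-int′ e (j ∸ suc t) (j∸suc<j t p))

  Wf-neighbours : ∀ e t y → t < j → Adj (Wf e (suc t)) y → y ≡ Wf e t ⊎ y ≡ Wf e (suc (suc t))
  Wf-neighbours e t y p (e′ , s′ , _ , inj₁ (eqx , eqy))
    with Wf-interior-index e′ s′ e (fromℕ< p) (trans (≡sym eqx) (W-int′ e t p))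
  ... | refl , eqs rewrite toℕ-fromℕ< p = inj₂ (trans eqy (cong (λ z → Wf e (suc z)) eqs))
  Wf-neighbours e t y p (e′ , s′ , _ , inj₂ (eqy , eqx))
    with Wf-interior-index e′ (suc s′) e (fromℕ< p) (trans (≡sym eqx) (W-int′ e t p))
  ... | refl , eqs rewrite toℕ-fromℕ< p = inj₁ (trans eqy (cong (Wf e) (suc-injective eqs)))

  W-neighbours : ∀ e d t y → t < j → Adj (W e d (suc t)) y → y ≡ W e d t ⊎ y ≡ W e d (suc (suc t))
  W-neighbours e false t y p a = Wf-neighbours e t y p a
  W-neighbours e true t y p a with Wf-neighbours e (j ∸ suc t) y (j∸suc<j t p) (subst (λ z → Adj (Wf e z) y) (+-∸-assoc 1 p) a)
  ... | inj₁ q = inj₂ q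
  ... | inj₂ q = inj₁ (trans q (cong (Wf e) (≡sym (trans (+-∸-assoc 1 (<⇒≤ p)) (cong suc (+-∸-assoc 1 p))))))

  -- positions along a path are recovered from the vertices, so W e d is injective
  position : Fin m → SV → ℕ
  position e (inj₁ a) with a ≟ endp e false
  ... | yes _ = 0
  ... | no _ = suc j
  position e (inj₂ (_ , i)) = suc (toℕ i)

  position-Wf : ∀ e s → s ≤ suc j → position e (Wf e s) ≡ s
  position-Wf e zero _ with endp e false ≟ endp e false
  ... | yes _ = refl
  ... | no ne = ⊥-elim (ne refl)
  position-Wf e (suc t) (s≤s t≤j) with t <?ℕ j
  ... | yes p = cong suc (toℕ-fromℕ< p)
  ... | no np with endp e true ≟ endp e false
  ...   | yes eq = ⊥-elim (endp-≢ e true eq)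
  ...   | no _ = cong suc (≤-antisym (≮⇒≥ np) t≤j)

  Wf-inj : ∀ e s s′ → s ≤ suc j → s′ ≤ suc j → Wf e s ≡ Wf e s′ → s ≡ s′
  Wf-inj e s s′ p p′ eq = trans (≡sym (position-Wf e s p)) (trans (cong (position e) eq) (position-Wf e s′ p′))

  W-inj : ∀ e d s s′ → s ≤ suc j → s′ ≤ suc j → W e d s ≡ W e d s′ → s ≡ s′
  W-inj e false = Wf-inj e
  W-inj e true s s′ p p′ eq = ∸-cancelˡ-≡ p p′ (Wf-inj e _ _ (m∸n≤m (suc j) s) (m∸n≤m (suc j) s′) eq)

  neighbour-of-original : ∀ a y → Adj (inj₁ a) y → Σ (Fin m) λ e → Σ Bool λ d → endp e d ≡ a × y ≡ W e d 1
  neighbour-of-original a y (e , zero , _ , inj₁ (eqx , eqy)) = e , false , ≡sym (inj₁-injective eqx) , eqy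
  neighbour-of-original a y (e , suc t , p , inj₁ (eqx , eqy)) with W-internal e false t p
  ... | i , eq = ⊥-elim (inj₁≢inj₂ (trans eqx eq))
  neighbour-of-original a y (e , s , p , inj₂ (eqy , eqx)) with Wf-original-index e s a p (≡sym eqx)
  ... | refl , refl = e , true , refl , eqy

  W-first-injective : ∀ e d e′ d′ → endp e d ≡ endp e′ d′ → W e d 1 ≡ W e′ d′ 1 → e ≡ e′ × d ≡ d′
  W-first-injective e d e′ d′ p q with 0 <?ℕ j
  ... | yes j>0 with W-internal e d 0 j>0 | W-internal e′ d′ 0 j>0
  ...   | i , eq | i′ , eq′ with inj₂-injective (trans (≡sym eq) (trans q eq′))
  ...     | refl = refl , endp-direction e d d′ p
    where
    endp-direction : ∀ e d d′ → endp e d ≡ endp e d′ → d ≡ d′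
    endp-direction e false false _ = refl
    endp-direction e true true _ = refl
    endp-direction e false true eq = ⊥-elim (endp-≢ e false eq)
    endp-direction e true false eq = ⊥-elim (endp-≢ e true eq)
  W-first-injective e d e′ d′ p q | no j≯0 =
    endp-injective e d e′ d′ p (inj₁-injective (trans (≡sym (W1 e d)) (trans q (W1 e′ d′))))
    where
    j0 : j ≡ 0
    j0 = n≤0⇒n≡0 (≮⇒≥ j≯0)
    W1 : ∀ e d → W e d 1 ≡ inj₁ (endp e (not d))
    W1 e d = subst (λ z → W e d (suc z) ≡ inj₁ (endp e (not d))) j0 (W-last e d)

-- Lifting a self-map g of G that preserves adjacency to the subdivision: Φ g fixes
-- the role of original vertices and carries the path of an edge uv onto the path
-- of the edge g(u)g(v), read in the matching direction.
module Lifting (G : Graph) (j : ℕ) where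
  open SubdivisionPaths G j
  open import Data.Bool using (_xor_)
  open import Data.Bool.Properties using (not-involutive)

  Pres : (V G → V G) → Set
  Pres g = ∀ a b → adj G (g a) (g b) ≡ adj G a b

  -- the edge, with direction, running from a to b (a dummy e₀ if there is none)
  edgeFrom : ∀ a b (w : Bool) → adj G a b ≡ w → Fin m → Fin m × Bool
  edgeFrom a b true ab e₀ = proj₁ (adj⇒edge a b ab) , proj₁ (proj₂ (adj⇒edge a b ab))
  edgeFrom a b false _ e₀ = e₀ , false

  edgeBetween : V G → V G → Fin m → Fin m × Bool
  edgeBetween a b = edgeFrom a b (adj G a b) refl

  edgeFrom-spec : ∀ a b w (ab : adj G a b ≡ w) e₀ → w ≡ true →
    endp (proj₁ (edgeFrom a b w ab e₀)) (proj₂ (edgeFrom a b w ab e₀)) ≡ a ×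
    endp (proj₁ (edgeFrom a b w ab e₀)) (not (proj₂ (edgeFrom a b w ab e₀))) ≡ b
  edgeFrom-spec a b true ab e₀ _ = proj₂ (proj₂ (adj⇒edge a b ab))

  τ : (V G → V G) → Fin m → Fin m × Bool
  τ g e = edgeBetween (g (endp e false)) (g (endp e true)) e

  τ-spec : ∀ g → Pres g → ∀ e →
    endp (proj₁ (τ g e)) (proj₂ (τ g e)) ≡ g (endp e false) ×
    endp (proj₁ (τ g e)) (not (proj₂ (τ g e))) ≡ g (endp e true)
  τ-spec g pres e = edgeFrom-spec (g (endp e false)) (g (endp e true)) _ refl e (trans (pres _ _) (endp-adj e))

  τ-spec-dir : ∀ g → Pres g → ∀ e d →
    endp (proj₁ (τ g e)) (d xor proj₂ (τ g e)) ≡ g (endp e d) ×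
    endp (proj₁ (τ g e)) (not (d xor proj₂ (τ g e))) ≡ g (endp e (not d))
  τ-spec-dir g pres e false = τ-spec g pres e
  τ-spec-dir g pres e true =
    proj₂ (τ-spec g pres e) ,
    trans (cong (endp (proj₁ (τ g e))) (not-involutive (proj₂ (τ g e)))) (proj₁ (τ-spec g pres e))

  Φ : (V G → V G) → SV → SV
  Φ g (inj₁ a) = inj₁ (g a)
  Φ g (inj₂ (e , i)) = W (proj₁ (τ g e)) (proj₂ (τ g e)) (suc (toℕ i))

  Φ-Wf : ∀ g → Pres g → ∀ e s → s ≤ suc j → Φ g (Wf e s) ≡ W (proj₁ (τ g e)) (proj₂ (τ g e)) s
  Φ-Wf g pres e zero _ = ≡sym (trans (W-0 (proj₁ (τ g e)) (proj₂ (τ g e))) (cong inj₁ (proj₁ (τ-spec g pres e))))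
  Φ-Wf g pres e (suc t) (s≤s t≤j) = by-cases (t <?ℕ j)
    where
    by-cases : Dec (t < j) → Φ g (Wf e (suc t)) ≡ W (proj₁ (τ g e)) (proj₂ (τ g e)) (suc t)
    by-cases (yes t<j) = trans (cong (Φ g) (W-int′ e t t<j))
                               (cong (λ z → W (proj₁ (τ g e)) (proj₂ (τ g e)) (suc z)) (toℕ-fromℕ< t<j))
    by-cases (no t≮j) with ≤-antisym t≤j (≮⇒≥ t≮j)
    ... | refl = trans (cong (Φ g) (W-end e))
                       (≡sym (trans (W-last (proj₁ (τ g e)) (proj₂ (τ g e))) (cong inj₁ (proj₂ (τ-spec g pres e)))))

  Φ-W : ∀ g → Pres g → ∀ e d s → s ≤ suc j → Φ g (W e d s) ≡ W (proj₁ (τ g e)) (d xor proj₂ (τ g e)) s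
  Φ-W g pres e false s s≤ = Φ-Wf g pres e s s≤
  Φ-W g pres e true s s≤ =
    trans (Φ-Wf g pres e (suc j ∸ s) (m∸n≤m (suc j) s)) (≡sym (W-flip (proj₁ (τ g e)) (proj₂ (τ g e)) s s≤))

  Φ-path : ∀ g → Pres g → ∀ e d e′ d′ → endp e′ d′ ≡ g (endp e d) → endp e′ (not d′) ≡ g (endp e (not d)) →
           ∀ s → s ≤ suc j → Φ g (W e d s) ≡ W e′ d′ s
  Φ-path g pres e d e′ d′ p q s s≤
    with endp-injective (proj₁ (τ g e)) (d xor proj₂ (τ g e)) e′ d′
           (trans (proj₁ (τ-spec-dir g pres e d)) (≡sym p)) (trans (proj₂ (τ-spec-dir g pres e d)) (≡sym q))
  ... | refl , refl = Φ-W g pres e d s s≤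

  interior-≤ : ∀ (i : Fin j) → suc (toℕ i) ≤ suc j
  interior-≤ i = s≤s (<⇒≤ (toℕ<n i))

  Φ-Adj : ∀ g → Pres g → ∀ x y → Adj x y → Adj (Φ g x) (Φ g y)
  Φ-Adj g pres x y (e , s , s≤j , inj₁ (refl , refl)) =
    subst₂ Adj (≡sym (Φ-Wf g pres e s (m≤n⇒m≤1+n s≤j))) (≡sym (Φ-Wf g pres e (suc s) (s≤s s≤j)))
           (W-adj (proj₁ (τ g e)) (proj₂ (τ g e)) s s≤j)
  Φ-Adj g pres x y (e , s , s≤j , inj₂ (refl , refl)) = Adj-sym (Φ-Adj g pres _ _ (e , s , s≤j , inj₁ (refl , refl)))

  Φ-inv : ∀ g h → Pres g → Pres h → (∀ a → h (g a) ≡ a) → ∀ x → Φ h (Φ g x) ≡ x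
  Φ-inv g h pg ph hg (inj₁ a) = cong inj₁ (hg a)
  Φ-inv g h pg ph hg (inj₂ (e , i)) =
    trans (Φ-path h ph (proj₁ (τ g e)) (proj₂ (τ g e)) e false
                  (≡sym (trans (cong h (proj₁ (τ-spec g pg e))) (hg _)))
                  (≡sym (trans (cong h (proj₂ (τ-spec g pg e))) (hg _)))
                  (suc (toℕ i)) (interior-≤ i))
          (W-int e i)

  Φ-id : ∀ g → (∀ a → g a ≡ a) → ∀ x → Φ g x ≡ x
  Φ-id g g≗id (inj₁ a) = cong inj₁ (g≗id a)
  Φ-id g g≗id (inj₂ (e , i)) =
    trans (cong (Φ g) (≡sym (W-int e i)))
          (trans (Φ-path g pres e false e false (≡sym (g≗id _)) (≡sym (g≗id _)) (suc (toℕ i)) (interior-≤ i)) (W-int e i))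
    where
    pres : Pres g
    pres a b = cong₂ (adj G) (g≗id a) (g≗id b)

  Φ-resp : ∀ g g′ → (∀ a → g a ≡ g′ a) → ∀ x → Φ g x ≡ Φ g′ x
  Φ-resp g g′ g≗g′ (inj₁ a) = cong inj₁ (g≗g′ a)
  Φ-resp g g′ g≗g′ (inj₂ (e , i)) rewrite g≗g′ (endp e false) | g≗g′ (endp e true) = refl

module Degrees (G : Graph) where
  Many : V G → Set
  Many b = Σ (V G) λ x → Σ (V G) λ y → Σ (V G) λ z →
    adj G b x ≡ true × adj G b y ≡ true × adj G b z ≡ true × ¬ x ≡ y × ¬ x ≡ z × ¬ y ≡ z

  Few : V G → Set
  Few b = ∀ x y → adj G b x ≡ true → adj G b y ≡ true → x ≡ y

module SubdivisionAutomorphisms (G : Graph) (j : ℕ) where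
  open SubdivisionPaths G j
  open Lifting G j
  open Degrees G
  open import Data.Sum.Properties using (inj₁-injective)

  record SubAut (F : SV → SV) : Set where
    field
      inj : ∀ x y → F x ≡ F y → x ≡ y
      surj : ∀ y → ∃ λ x → F x ≡ y
      fwd : ∀ x y → Adj x y → Adj (F x) (F y)
      bwd : ∀ x y → Adj (F x) (F y) → Adj x y

  -- If F maps an endpoint of a subdivided edge to an original vertex a′, it maps the
  -- whole path onto a path leaving a′: the first step is forced by
  -- `neighbour-of-original`, and each further step by injectivity, since an
  -- internal vertex has only two neighbours.  Consequently original vertices
  -- propagate along edges of G, and by connectivity to all of G.
  module PathImages (F : SV → SV) (sa : SubAut F) where
    open SubAut sa

    path-image : ∀ e d a′ → F (inj₁ (endp e d)) ≡ inj₁ a′ →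
      Σ (Fin m) λ e′ → Σ Bool λ d′ → endp e′ d′ ≡ a′ × (∀ s → s ≤ suc j → F (W e d s) ≡ W e′ d′ s)
    path-image e d a′ Fa
      with neighbour-of-original a′ (F (W e d 1))
             (subst (λ z → Adj z (F (W e d 1))) (trans (cong F (W-0 e d)) Fa) (fwd _ _ (W-adj e d 0 z≤n)))
    ... | e′ , d′ , p , first = e′ , d′ , p , along
      where
      Agrees : ℕ → Set
      Agrees s = F (W e d s) ≡ W e′ d′ s
      start : Agrees 0
      start = trans (cong F (W-0 e d)) (trans Fa (≡sym (trans (W-0 e′ d′) (cong inj₁ p))))
      -- induction on pairs of consecutive positions: F (W e d (t + 2)) is a neighbour
      -- of W e′ d′ (t + 1) other than F (W e d t) = W e′ d′ t
      steps : ∀ t → t ≤ j → Agrees t × Agrees (suc t)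
      steps zero _ = start , first
      steps (suc t) t<j with steps t (≤-trans (n≤1+n t) t<j)
      ... | at , at+1 with W-neighbours e′ d′ t (F (W e d (suc (suc t)))) t<j
                             (subst (λ z → Adj z (F (W e d (suc (suc t))))) at+1 (fwd _ _ (W-adj e d (suc t) t<j)))
      ...   | inj₂ at+2 = at+1 , at+2
      ...   | inj₁ back = ⊥-elim (t+2≢t (W-inj e d (suc (suc t)) t (s≤s t<j)
                                    (≤-trans (n≤1+n t) (≤-trans (n≤1+n (suc t)) (s≤s t<j)))
                                    (inj _ _ (trans back (≡sym at)))))
        where
        t+2≢t : ∀ {t} → ¬ suc (suc t) ≡ t
        t+2≢t ()
      along : ∀ s → s ≤ suc j → Agrees s
      along zero _ = start
      along (suc t) (s≤s t≤j) = proj₂ (steps t t≤j)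

    far-end : ∀ e d e′ d′ → (∀ s → s ≤ suc j → F (W e d s) ≡ W e′ d′ s) →
              F (inj₁ (endp e (not d))) ≡ inj₁ (endp e′ (not d′))
    far-end e d e′ d′ along = trans (cong F (≡sym (W-last e d))) (trans (along (suc j) ≤-refl) (W-last e′ d′))

    Original : V G → Set
    Original a = Σ (V G) λ a′ → F (inj₁ a) ≡ inj₁ a′

    original-step : ∀ a b → adj G a b ≡ true → Original a → Original b
    original-step a b ab (a′ , Fa) with adj⇒edge a b ab
    ... | e , d , refl , refl with path-image e d a′ Fa
    ...   | e′ , d′ , _ , along = endp e′ (not d′) , far-end e d e′ d′ along

    original-spreads : ∀ a b → Reach G a b → Original a → Original b
    original-spreads a .a here o = o
    original-spreads a b (step {v = c} ac r) o = original-spreads c b r (original-step a c ac o)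

  -- The restriction of F to the original vertices (the default a is never used
  -- once F preserves originality).
  originalOr : SV → V G → V G
  originalOr (inj₁ a′) _ = a′
  originalOr (inj₂ _) a = a

  restrict : (SV → SV) → V G → V G
  restrict F a = originalOr (F (inj₁ a)) a

  module Restriction (F : SV → SV) (sa : SubAut F) (original : ∀ a → Σ (V G) λ a′ → F (inj₁ a) ≡ inj₁ a′) where
    open SubAut sa
    open PathImages F sa

    ψ : V G → V G
    ψ = restrict F

    Fψ : ∀ a → F (inj₁ a) ≡ inj₁ (ψ a)
    Fψ a with original a
    ... | a′ , eq rewrite eq = refl

    ψ-inj : ∀ a b → ψ a ≡ ψ b → a ≡ b
    ψ-inj a b eq = inj₁-injective (inj _ _ (trans (Fψ a) (trans (cong inj₁ eq) (≡sym (Fψ b)))))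

    -- an internal vertex is the image of an internal vertex, so every original
    -- vertex is hit by an original vertex
    ψ-surj : ∀ a′ → ∃ λ a → ψ a ≡ a′
    ψ-surj a′ with surj (inj₁ a′)
    ... | inj₁ a , eq = a , inj₁-injective (trans (≡sym (Fψ a)) eq)
    ... | inj₂ (e , i) , eq with path-image e false (ψ (endp e false)) (Fψ _)
    ...   | e′ , d′ , _ , along with W-internal e′ d′ (toℕ i) (toℕ<n i)
    ...     | i′ , eqi = ⊥-elim (inj₁≢inj₂ (≡sym (trans (≡sym eqi)
                            (trans (≡sym (along (suc (toℕ i)) (interior-≤ i))) (trans (cong F (W-int e i)) eq)))))

    ψ-edge : ∀ a b → adj G a b ≡ true →
             Σ (Fin m) λ e′ → Σ Bool λ d′ → endp e′ d′ ≡ ψ a × endp e′ (not d′) ≡ ψ b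
    ψ-edge a b ab with adj⇒edge a b ab
    ... | e , d , refl , refl with path-image e d (ψ (endp e d)) (Fψ _)
    ...   | e′ , d′ , p , along = e′ , d′ , p , inj₁-injective (trans (≡sym (far-end e d e′ d′ along)) (Fψ _))

    -- conversely, a path leaving ψ a starts at the image of a neighbour of a in H,
    -- whose path from a is mapped onto it; its far end is then b
    ψ-edge⁻ : ∀ a b → adj G (ψ a) (ψ b) ≡ true → adj G a b ≡ true
    ψ-edge⁻ a b ψab with adj⇒edge (ψ a) (ψ b) ψab
    ... | e′ , d′ , p , q with surj (W e′ d′ 1)
    ...   | x , Fx with neighbour-of-original a x
                          (bwd _ _ (subst₂ Adj (trans (W-0 e′ d′) (trans (cong inj₁ p) (≡sym (Fψ a)))) (≡sym Fx)
                                                (W-adj e′ d′ 0 z≤n)))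
    ...     | e , d , refl , refl with path-image e d (ψ (endp e d)) (Fψ _)
    ...       | e″ , d″ , p″ , along with W-first-injective e″ d″ e′ d′ (trans p″ (≡sym p)) (trans (≡sym (along 1 (s≤s z≤n))) Fx)
    ...         | refl , refl = subst (λ z → adj G (endp e d) z ≡ true) far (endp-adj-dir e d)
      where
      far : endp e (not d) ≡ b
      far = inj₁-injective (inj _ _ (trans (far-end e d e″ d″ along) (trans (cong inj₁ q) (≡sym (Fψ b)))))

    ψ-pres : Pres ψ
    ψ-pres a b = bool-iff (λ t → ≡→T (ψ-edge⁻ a b (T→≡ t))) forward
      where
      forward : T (adj G a b) → T (adj G (ψ a) (ψ b))
      forward t with ψ-edge a b (T→≡ t)
      ... | e′ , d′ , p , q = subst₂ (λ u v → T (adj G u v)) p q (≡→T (endp-adj-dir e′ d′))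

    Φψ : ∀ x → Φ ψ x ≡ F x
    Φψ (inj₁ a) = ≡sym (Fψ a)
    Φψ (inj₂ (e , i)) with path-image e false (ψ (endp e false)) (Fψ _)
    ... | e′ , d′ , p , along =
      trans (cong (Φ ψ) (≡sym (W-int e i)))
            (trans (Φ-path ψ ψ-pres e false e′ d′ p (inj₁-injective (trans (≡sym (far-end e false e′ d′ along)) (Fψ _)))
                           (suc (toℕ i)) (interior-≤ i))
                   (trans (≡sym (along (suc (toℕ i)) (interior-≤ i))) (cong F (W-int e i))))

  -- Suppose F maps the original vertex b to the internal vertex (e , i).  The
  -- neighbours of b in H are the first vertices `towards b x` of the paths to the
  -- neighbours x of b, and F maps them injectively onto the two neighbours of
  -- (e , i) on its path.  So b has neither three neighbours nor fewer than two.
  module InteriorImage (F : SV → SV) (sa : SubAut F) (b : V G) (e : Fin m) (i : Fin j)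
                       (Fb≡ : F (inj₁ b) ≡ inj₂ (e , i)) where
    open SubAut sa

    t : ℕ
    t = toℕ i

    Fb : F (inj₁ b) ≡ W e false (suc t)
    Fb = trans Fb≡ (≡sym (W-int e i))

    towards : ∀ x → adj G b x ≡ true → SV
    towards x bx = W (proj₁ (adj⇒edge b x bx)) (proj₁ (proj₂ (adj⇒edge b x bx))) 1

    towards-injective : ∀ x y (bx : adj G b x ≡ true) (by : adj G b y ≡ true) → towards x bx ≡ towards y by → x ≡ y
    towards-injective x y bx by eq with adj⇒edge b x bx | adj⇒edge b y by
    ... | ex , dx , px , qx | ey , dy , py , qy with W-first-injective ex dx ey dy (trans px (≡sym py)) eq
    ...   | refl , refl = trans (≡sym qx) qy

    towards-image : ∀ x (bx : adj G b x ≡ true) →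
      F (towards x bx) ≡ W e false t ⊎ F (towards x bx) ≡ W e false (suc (suc t))
    towards-image x bx with adj⇒edge b x bx
    ... | ex , dx , px , qx =
      W-neighbours e false t _ (toℕ<n i)
        (subst (λ z → Adj z (F (W ex dx 1))) Fb
               (fwd _ _ (subst (λ z → Adj z (W ex dx 1)) (trans (W-0 ex dx) (cong inj₁ px)) (W-adj ex dx 0 z≤n))))

    distinct-images : ∀ x y (bx : adj G b x ≡ true) (by : adj G b y ≡ true) → ¬ x ≡ y →
                      ¬ F (towards x bx) ≡ F (towards y by)
    distinct-images x y bx by x≢y eq = x≢y (towards-injective x y bx by (inj _ _ eq))

    -- three neighbours cannot be mapped injectively onto two vertices
    ¬many : ¬ Many b
    ¬many (x , y , z , bx , by , bz , x≢y , x≢z , y≢z) with towards-image x bx | towards-image y by | towards-image z bz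
    ... | inj₁ p | inj₁ q | _ = distinct-images x y bx by x≢y (trans p (≡sym q))
    ... | inj₂ p | inj₂ q | _ = distinct-images x y bx by x≢y (trans p (≡sym q))
    ... | inj₁ p | inj₂ _ | inj₁ r = distinct-images x z bx bz x≢z (trans p (≡sym r))
    ... | inj₁ _ | inj₂ q | inj₂ r = distinct-images y z by bz y≢z (trans q (≡sym r))
    ... | inj₂ p | inj₁ _ | inj₂ r = distinct-images x z bx bz x≢z (trans p (≡sym r))
    ... | inj₂ _ | inj₁ q | inj₁ r = distinct-images y z by bz y≢z (trans q (≡sym r))

    -- the two path-neighbours of F b have preimages adjacent to b, which lie on
    -- paths from b to neighbours of b; if b has only one neighbour they coincide
    ¬few : ¬ Few b
    ¬few few with surj (W e false t) | surj (W e false (suc (suc t)))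
    ... | xa , Fxa | xb , Fxb
      with neighbour-of-original b xa (bwd _ _ (subst₂ Adj (≡sym Fb) (≡sym Fxa) (Adj-sym (W-adj e false t (<⇒≤ (toℕ<n i))))))
         | neighbour-of-original b xb (bwd _ _ (subst₂ Adj (≡sym Fb) (≡sym Fxb) (W-adj e false (suc t) (toℕ<n i))))
    ...   | ea , da , pa , qa | eb , db , pb , qb
      with endp-injective ea da eb db (trans pa (≡sym pb))
             (few _ _ (subst (λ z → adj G z (endp ea (not da)) ≡ true) pa (endp-adj-dir ea da))
                      (subst (λ z → adj G z (endp eb (not db)) ≡ true) pb (endp-adj-dir eb db)))
    ...     | refl , refl = t≢t+2 (W-inj e false t (suc (suc t)) (≤-trans (<⇒≤ (toℕ<n i)) (n≤1+n j)) (s≤s (toℕ<n i))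
                                         (trans (≡sym Fxa) (trans (cong F (trans qa (≡sym qb))) Fxb)))
      where
      t≢t+2 : ∀ {t} → ¬ t ≡ suc (suc t)
      t≢t+2 ()

  branch-vertex-stays-original : ∀ F → SubAut F → ∀ b → Many b ⊎ Few b → Σ (V G) λ a′ → F (inj₁ b) ≡ inj₁ a′
  branch-vertex-stays-original F sa b many-or-few with F (inj₁ b) in Fb
  ... | inj₁ a′ = a′ , refl
  ... | inj₂ (e , i) with many-or-few
  ...   | inj₁ many = ⊥-elim (InteriorImage.¬many F sa b e i Fb many)
  ...   | inj₂ few = ⊥-elim (InteriorImage.¬few F sa b e i Fb few)

module Correspondence (G : Graph) (j : ℕ) where
  open SubdivisionPaths G j
  open Lifting G j
  open SubdivisionAutomorphisms G j
  open AutomorphismCounting using (AutCorrespondence)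

  H : Graph
  H = subdivisionSuc G j

  toSV : V H → SV
  toSV = decode G j

  fromSV : SV → V H
  fromSV (inj₁ a) = a ↑ˡ (m * j)
  fromSV (inj₂ (e , i)) = n ↑ʳ combine e i

  private
    toSV-spec : ∀ x → toSV x ≡ [ inj₁ , (λ y → inj₂ (remQuot {m} j y)) ]′ (splitAt n x)
    toSV-spec x with splitAt (order G) x
    ... | inj₁ a = refl
    ... | inj₂ y = refl

  toSV-fromSV : ∀ s → toSV (fromSV s) ≡ s
  toSV-fromSV (inj₁ a) rewrite toSV-spec (a ↑ˡ (m * j)) | splitAt-↑ˡ n a (m * j) = refl
  toSV-fromSV (inj₂ (e , i))
    rewrite toSV-spec (n ↑ʳ combine e i) | splitAt-↑ʳ n (m * j) (combine e i) | remQuot-combine {m} {j} e i = refl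

  fromSV-toSV : ∀ x → fromSV (toSV x) ≡ x
  fromSV-toSV x rewrite toSV-spec x with splitAt n x in eq
  ... | inj₁ a = splitAt⁻¹-↑ˡ eq
  ... | inj₂ y = trans (cong (n ↑ʳ_) (combine-remQuot {m} j y)) (splitAt⁻¹-↑ʳ eq)

  fromSV-injective : ∀ s t → fromSV s ≡ fromSV t → s ≡ t
  fromSV-injective s t eq = trans (≡sym (toSV-fromSV s)) (trans (cong toSV eq) (toSV-fromSV t))

  toSV-injective : ∀ x y → toSV x ≡ toSV y → x ≡ y
  toSV-injective x y eq = trans (≡sym (fromSV-toSV x)) (trans (cong fromSV eq) (fromSV-toSV y))

  Adj-transfer : ∀ {x y x′ y′} → adjᴴ x′ y′ ≡ adjᴴ x y → (Adj x y → Adj x′ y′) × (Adj x′ y′ → Adj x y)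
  Adj-transfer {x} {y} {x′} {y′} eq =
    (λ a → adjᴴ→Adj x′ y′ (subst T (≡sym eq) (Adj→adjᴴ x y a))) ,
    (λ a → adjᴴ→Adj x y (subst T eq (Adj→adjᴴ x′ y′ a)))

  onSV : (V H → V H) → SV → SV
  onSV f s = toSV (f (fromSV s))

  onSV-SubAut : ∀ f → IsAutomorphism H f → SubAut (onSV f)
  onSV-SubAut f af = record
    { inj = λ x y eq → fromSV-injective x y (IsIso.injective af _ _ (toSV-injective _ _ eq))
    ; surj = λ y → let (x , eq) = IsIso.surjective af (fromSV y) in
                   toSV x , trans (cong (λ z → toSV (f z)) (fromSV-toSV x)) (trans (cong toSV eq) (toSV-fromSV y))
    ; fwd = λ x y → proj₁ (Adj-transfer (same-adjacency x y))
    ; bwd = λ x y → proj₂ (Adj-transfer (same-adjacency x y)) }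
    where
    same-adjacency : ∀ x y → adjᴴ (onSV f x) (onSV f y) ≡ adjᴴ x y
    same-adjacency x y = trans (IsIso.preserves af (fromSV x) (fromSV y)) (cong₂ adjᴴ (toSV-fromSV x) (toSV-fromSV y))

  lift : (V G → V G) → (V H → V H)
  lift g x = fromSV (Φ g (toSV x))

  restrictH : (V H → V H) → (V G → V G)
  restrictH f = restrict (onSV f)

  inverse : ∀ g → IsAutomorphism G g → V G → V G
  inverse g ag a = proj₁ (IsIso.surjective ag a)

  inverse-right : ∀ g (ag : IsAutomorphism G g) a → g (inverse g ag a) ≡ a
  inverse-right g ag a = proj₂ (IsIso.surjective ag a)

  inverse-left : ∀ g (ag : IsAutomorphism G g) a → inverse g ag (g a) ≡ a
  inverse-left g ag a = IsIso.injective ag _ _ (inverse-right g ag (g a))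

  inverse-pres : ∀ g (ag : IsAutomorphism G g) → Pres (inverse g ag)
  inverse-pres g ag a b = trans (≡sym (IsIso.preserves ag _ _)) (cong₂ (adj G) (inverse-right g ag a) (inverse-right g ag b))

  -- the lift of an automorphism is an automorphism, with the lift of its inverse
  -- as inverse
  lift-aut : ∀ g → IsAutomorphism G g → IsAutomorphism H (lift g)
  lift-aut g ag = record
    { injective = λ x y eq → toSV-injective x y
        (trans (≡sym (Φ-inv g h pg ph hg (toSV x)))
               (trans (cong (Φ h) (fromSV-injective (Φ g (toSV x)) (Φ g (toSV y)) eq)) (Φ-inv g h pg ph hg (toSV y))))
    ; surjective = λ y → fromSV (Φ h (toSV y)) ,
        trans (cong (λ z → fromSV (Φ g z)) (toSV-fromSV (Φ h (toSV y))))
              (trans (cong fromSV (Φ-inv h g ph pg gh (toSV y))) (fromSV-toSV y))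
    ; preserves = λ x y → trans (cong₂ adjᴴ (toSV-fromSV (Φ g (toSV x))) (toSV-fromSV (Φ g (toSV y))))
                                (bool-iff (reflects (toSV x) (toSV y)) (preserves (toSV x) (toSV y))) }
    where
    h : V G → V G
    h = inverse g ag
    pg : Pres g
    pg = IsIso.preserves ag
    ph : Pres h
    ph = inverse-pres g ag
    hg : ∀ a → h (g a) ≡ a
    hg = inverse-left g ag
    gh : ∀ a → g (h a) ≡ a
    gh = inverse-right g ag
    preserves : ∀ x y → T (adjᴴ x y) → T (adjᴴ (Φ g x) (Φ g y))
    preserves x y t = Adj→adjᴴ (Φ g x) (Φ g y) (Φ-Adj g pg x y (adjᴴ→Adj x y t))
    reflects : ∀ x y → T (adjᴴ (Φ g x) (Φ g y)) → T (adjᴴ x y)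
    reflects x y t = Adj→adjᴴ x y (subst₂ Adj (Φ-inv g h pg ph hg x) (Φ-inv g h pg ph hg y)
                                          (Φ-Adj h ph (Φ g x) (Φ g y) (adjᴴ→Adj (Φ g x) (Φ g y) t)))

  module _ (original : ∀ F → SubAut F → ∀ a → Σ (V G) λ a′ → F (inj₁ a) ≡ inj₁ a′) where
    private
      module RestrictionOf (f : V H → V H) (af : IsAutomorphism H f) =
        Restriction (onSV f) (onSV-SubAut f af) (original _ (onSV-SubAut f af))

    restrict-aut : ∀ f → IsAutomorphism H f → IsAutomorphism G (restrictH f)
    restrict-aut f af = record { injective = ψ-inj ; surjective = ψ-surj ; preserves = ψ-pres }
      where open RestrictionOf f af

    aut-correspondence : AutCorrespondence G H
    aut-correspondence = record
      { φ = lift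
      ; ψ = restrictH
      ; φ-aut = lift-aut
      ; ψ-aut = restrict-aut
      ; φ-resp = λ g g′ _ _ g≗g′ x → cong fromSV (Φ-resp g g′ g≗g′ (toSV x))
      ; ψ-resp = λ f f′ _ _ f≗f′ a → cong (λ z → originalOr (toSV z) a) (f≗f′ (fromSV (inj₁ a)))
      ; ψφ = λ g _ a → cong (λ z → originalOr z a) (trans (toSV-fromSV _) (cong (Φ g) (toSV-fromSV (inj₁ a))))
      ; φψ = λ f af x → trans (cong fromSV (RestrictionOf.Φψ f af (toSV x))) (trans (fromSV-toSV _) (cong f (fromSV-toSV x)))
      }

    -- Colour every internal vertex like some fixed vertex z₀.  An automorphism f
    -- of H fixing the colours has a colour-fixing restriction, which is therefore
    -- the identity; hence f = Φ id = id.
    extend-distinguishing : ∀ d (c : V G → Fin d) → IsDistinguishing G d c → V G →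
                            Σ (V H → Fin d) λ c′ → IsDistinguishing H d c′
    extend-distinguishing d c c-dist z₀ = c′ , c′-dist
      where
      colour : SV → Fin d
      colour (inj₁ a) = c a
      colour (inj₂ _) = c z₀
      c′ : V H → Fin d
      c′ x = colour (toSV x)
      c′-dist : IsDistinguishing H d c′
      c′-dist f af f-fixes x =
        trans (≡sym (AutCorrespondence.φψ aut-correspondence f af x))
              (trans (cong fromSV (Φ-id ψ ψ≗id (toSV x))) (fromSV-toSV x))
        where
        open RestrictionOf f af
        ψ-fixes : ∀ a → c (ψ a) ≡ c a
        ψ-fixes a = trans (cong colour (≡sym (Fψ a))) (trans (f-fixes (fromSV (inj₁ a))) (cong colour (toSV-fromSV (inj₁ a))))
        ψ≗id : ∀ a → ψ a ≡ a
        ψ≗id = c-dist ψ (restrict-aut f af) ψ-fixes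

module DegreeDecisions (G : Graph) where
  open Degrees G

  many? : ∀ b → Dec (Many b)
  many? b = any? λ x → any? λ y → any? λ z →
    (adj G b x Bool.≟ true) ×-dec (adj G b y Bool.≟ true) ×-dec (adj G b z Bool.≟ true) ×-dec
    ¬? (x ≟ y) ×-dec ¬? (x ≟ z) ×-dec ¬? (y ≟ z)

  few? : ∀ b → Dec (Few b)
  few? b = all? λ x → all? λ y → (adj G b x Bool.≟ true) →-dec ((adj G b y Bool.≟ true) →-dec (x ≟ y))

  Two : V G → Set
  Two b = Σ (V G) λ x → Σ (V G) λ y → adj G b x ≡ true × adj G b y ≡ true × ¬ x ≡ y

  two? : ∀ b → Dec (Two b)
  two? b = any? λ x → any? λ y → (adj G b x Bool.≟ true) ×-dec (adj G b y Bool.≟ true) ×-dec ¬? (x ≟ y)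

  ¬few→two : ∀ b → ¬ Few b → Two b
  ¬few→two b nf with two? b
  ... | yes t = t
  ... | no nt = ⊥-elim (nf λ x y bx by → dec-eq x y bx by)
    where
    dec-eq : ∀ x y → adj G b x ≡ true → adj G b y ≡ true → x ≡ y
    dec-eq x y bx by with x ≟ y
    ... | yes e = e
    ... | no ne = ⊥-elim (nt (x , y , bx , by , ne))

  only-two : ∀ b → ¬ Many b → (t : Two b) → ∀ z → adj G b z ≡ true → z ≡ proj₁ t ⊎ z ≡ proj₁ (proj₂ t)
  only-two b nm (x , y , bx , by , nxy) z bz with z ≟ x | z ≟ y
  ... | yes p | _ = inj₁ p
  ... | no _ | yes q = inj₂ q
  ... | no p | no q = ⊥-elim (nm (x , y , z , bx , by , bz , nxy , (λ e → p (≡sym e)) , (λ e → q (≡sym e))))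

-- Walk from v₀ without ever stepping back;
-- let L be the first time the walk revisits a vertex.  The revisited vertex must
-- be v₀ (an earlier one would get a third neighbour), so the walk closes up after
-- L steps.  Its L vertices are closed under adjacency, hence (by connectivity)
-- are all of G, so L = n and t ↦ walk t is an isomorphism from C_n onto G.
module TwoRegularIsCycle (G : Graph) (conn : Connected G) (n≥3 : 3 ≤ order G)
  (nb₁ nb₂ : V G → V G) (nb₁≢nb₂ : ∀ b → ¬ nb₁ b ≡ nb₂ b)
  (adj-nb₁ : ∀ b → adj G b (nb₁ b) ≡ true) (adj-nb₂ : ∀ b → adj G b (nb₂ b) ≡ true)
  (only-nb : ∀ b z → adj G b z ≡ true → z ≡ nb₁ b ⊎ z ≡ nb₂ b) where

  n : ℕ
  n = order G

  otherBy : ∀ c p → Dec (nb₁ c ≡ p) → V G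
  otherBy c p (yes _) = nb₂ c
  otherBy c p (no _) = nb₁ c

  other : V G → V G → V G
  other c p = otherBy c p (nb₁ c ≟ p)

  other-adj : ∀ c p → adj G c (other c p) ≡ true
  other-adj c p with nb₁ c ≟ p
  ... | yes _ = adj-nb₂ c
  ... | no _ = adj-nb₁ c

  other-≢ : ∀ c p → ¬ other c p ≡ p
  other-≢ c p with nb₁ c ≟ p
  ... | yes e = λ q → nb₁≢nb₂ c (trans e (≡sym q))
  ... | no ne = ne

  other-only : ∀ c p → adj G c p ≡ true → ∀ z → adj G c z ≡ true → z ≡ p ⊎ z ≡ other c p
  other-only c p cp z cz with nb₁ c ≟ p | only-nb c z cz
  ... | yes e | inj₁ z1 = inj₁ (trans z1 e)
  ... | yes e | inj₂ z2 = inj₂ z2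
  ... | no ne | inj₁ z1 = inj₂ z1
  ... | no ne | inj₂ z2 with only-nb c p cp
  ...   | inj₁ p1 = ⊥-elim (ne (≡sym p1))
  ...   | inj₂ p2 = inj₁ (trans z2 (≡sym p2))

  v₀ : V G
  v₀ = fromℕ< {0} (≤-trans (s≤s z≤n) n≥3)

  -- the non-backtracking walk: (previous vertex , current vertex)
  walkState : ℕ → V G × V G
  walkState zero = nb₁ v₀ , v₀
  walkState (suc t) = proj₂ (walkState t) , other (proj₂ (walkState t)) (proj₁ (walkState t))

  walk : ℕ → V G
  walk t = proj₂ (walkState t)

  previous : ℕ → V G
  previous t = proj₁ (walkState t)

  walk-back-adj : ∀ t → adj G (walk t) (previous t) ≡ true
  walk-back-adj zero = adj-nb₁ v₀
  walk-back-adj (suc t) = trans (sym G _ _) (other-adj (walk t) (previous t))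

  walk-adj : ∀ t → adj G (walk t) (walk (suc t)) ≡ true
  walk-adj t = other-adj (walk t) (previous t)

  walk-no-backtrack : ∀ t → ¬ walk (suc (suc t)) ≡ walk t
  walk-no-backtrack t = other-≢ (walk (suc t)) (walk t)

  walk-neighbours : ∀ t z → adj G (walk (suc t)) z ≡ true → z ≡ walk t ⊎ z ≡ walk (suc (suc t))
  walk-neighbours t z az = other-only (walk (suc t)) (walk t) (walk-back-adj (suc t)) z az

  start-neighbours : ∀ z → adj G (walk 0) z ≡ true → z ≡ nb₁ v₀ ⊎ z ≡ walk 1
  start-neighbours z az = other-only v₀ (nb₁ v₀) (adj-nb₁ v₀) z az

  adj⇒≢ : ∀ {x y} → adj G x y ≡ true → ¬ x ≡ y
  adj⇒≢ {x} xy refl = true≢false (trans (≡sym xy) (irrefl G x))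

  Repeats : ℕ → Set
  Repeats t = Σ (Fin t) λ i → walk (toℕ i) ≡ walk t

  repeats? : ∀ t → Dec (Repeats t)
  repeats? t = any? (λ i → walk (toℕ i) ≟ walk t)

  search-first-repeat : ∀ N → (Σ ℕ λ L → L ≤ N × Repeats L × (∀ t → t < L → ¬ Repeats t)) ⊎
                              (∀ t → t ≤ N → ¬ Repeats t)
  search-first-repeat zero = inj₂ λ { zero _ (() , _) }
  search-first-repeat (suc N) with search-first-repeat N
  ... | inj₁ (L , L≤N , r , mn) = inj₁ (L , ≤-trans L≤N (n≤1+n N) , r , mn)
  ... | inj₂ h with repeats? (suc N)
  ...   | yes r = inj₁ (suc N , ≤-refl , r , λ t t<sN → h t (≤-pred t<sN))
  ...   | no nr = inj₂ λ t t≤sN → case t t≤sN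
    where
    case : ∀ t → t ≤ suc N → ¬ Repeats t
    case t t≤sN with t ≟ℕ suc N
    ... | yes refl = nr
    ... | no ne = h t (≤-pred (≤∧≢⇒< t≤sN ne))

  -- by pigeonhole some repetition happens within n steps
  first-repeat : Σ ℕ λ L → L ≤ n × Repeats L × (∀ t → t < L → ¬ Repeats t)
  first-repeat with search-first-repeat n
  ... | inj₁ r = r
  ... | inj₂ h with pigeonhole (n<1+n n) (λ (i : Fin (suc n)) → walk (toℕ i))
  ...   | i , k , i<k , eq = ⊥-elim (h (toℕ k) (≤-pred (toℕ<n k)) (fromℕ< i<k , trans (cong walk (toℕ-fromℕ< i<k)) eq))

  L : ℕ
  L = proj₁ first-repeat
  L≤n : L ≤ n
  L≤n = proj₁ (proj₂ first-repeat)
  repL : Repeats L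
  repL = proj₁ (proj₂ (proj₂ first-repeat))
  minL : ∀ t → t < L → ¬ Repeats t
  minL = proj₂ (proj₂ (proj₂ first-repeat))

  walk-injective-below : ∀ a b → a < L → b < L → walk a ≡ walk b → a ≡ b
  walk-injective-below a b a<L b<L eq with <-cmp a b
  ... | tri≈ _ e _ = e
  ... | tri< a<b _ _ = ⊥-elim (minL b b<L (fromℕ< a<b , trans (cong walk (toℕ-fromℕ< a<b)) eq))
  ... | tri> _ _ b<a = ⊥-elim (minL a a<L (fromℕ< b<a , trans (cong walk (toℕ-fromℕ< b<a)) (≡sym eq)))

  repeat-index : Fin L
  repeat-index = proj₁ repL
  repeat-index-eq : walk (toℕ repeat-index) ≡ walk L
  repeat-index-eq = proj₂ repL

  L-positive : Σ ℕ λ L′ → L ≡ suc L′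
  L-positive with L | repL
  ... | zero | (() , _)
  ... | suc L′ | _ = L′ , refl

  L′ : ℕ
  L′ = proj₁ L-positive
  eqL : L ≡ suc L′
  eqL = proj₂ L-positive

  L′<L : L′ < L
  L′<L = subst (L′ <_) (≡sym eqL) (n<1+n L′)

  adjL : adj G (walk L′) (walk L) ≡ true
  adjL = subst (λ z → adj G (walk L′) (walk z) ≡ true) (≡sym eqL) (walk-adj L′)

  repeat-is-start : ∀ i → i < L → walk i ≡ walk L → i ≡ 0
  repeat-is-start zero _ _ = refl
  repeat-is-start (suc i′) i<L eq
    with walk-neighbours i′ (walk L′) (subst (λ z → adj G z (walk L′) ≡ true) (≡sym eq) (trans (sym G _ _) adjL))
  ... | inj₁ q = ⊥-elim (<-irrefl (≡sym (walk-injective-below L′ i′ L′<L (<-trans (n<1+n i′) i<L) q)) i′<L′)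
    where
    i′<L′ : i′ < L′
    i′<L′ = ≤-pred (subst (suc i′ <_) eqL i<L)
  ... | inj₂ q with suc (suc i′) ≟ℕ L
  ...   | yes e = ⊥-elim (adj⇒≢ adjL (trans q (cong walk e)))
  ...   | no ne with walk-injective-below L′ (suc (suc i′)) L′<L (≤∧≢⇒< i<L ne) q
  ...     | e = ⊥-elim (walk-no-backtrack (suc i′) (trans (cong walk (trans (cong suc (≡sym e)) (≡sym eqL))) (≡sym eq)))

  walk-closes : walk 0 ≡ walk L
  walk-closes = subst (λ z → walk z ≡ walk L)
                      (repeat-is-start (toℕ repeat-index) (toℕ<n repeat-index) repeat-index-eq) repeat-index-eq

  -- L ≥ 3: the walk neither stays put nor steps back
  L≢1 : ¬ L ≡ 1
  L≢1 e = adj⇒≢ (walk-adj 0) (trans walk-closes (cong walk e))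

  L≢2 : ¬ L ≡ 2
  L≢2 e = walk-no-backtrack 0 (≡sym (trans walk-closes (cong walk e)))

  1<L : 1 < L
  1<L = subst (1 <_) (≡sym eqL) (s≤s (n≢0⇒n>0 (λ e → L≢1 (trans eqL (cong suc e)))))

  walk-last : walk L′ ≡ nb₁ v₀
  walk-last
    with start-neighbours (walk L′) (subst (λ z → adj G z (walk L′) ≡ true) (≡sym walk-closes) (trans (sym G _ _) adjL))
  ... | inj₁ q = q
  ... | inj₂ q = ⊥-elim (L≢2 (trans eqL (cong suc (walk-injective-below L′ 1 L′<L 1<L q))))

  -- the first L vertices of the walk are closed under adjacency, so cover G
  OnWalk : V G → Set
  OnWalk x = Σ ℕ λ t → t < L × walk t ≡ x

  OnWalk-step : ∀ a b → adj G a b ≡ true → OnWalk a → OnWalk b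
  OnWalk-step a b ab (zero , t<L , refl) with start-neighbours b ab
  ... | inj₁ q = L′ , L′<L , trans walk-last (≡sym q)
  ... | inj₂ q = 1 , 1<L , ≡sym q
  OnWalk-step a b ab (suc t , t<L , refl) with walk-neighbours t b ab
  ... | inj₁ q = t , <-trans (n<1+n t) t<L , ≡sym q
  ... | inj₂ q with suc (suc t) ≟ℕ L
  ...   | yes e = 0 , ≤-trans (s≤s z≤n) 1<L , trans walk-closes (trans (cong walk (≡sym e)) (≡sym q))
  ...   | no ne = suc (suc t) , ≤∧≢⇒< t<L ne , ≡sym q

  OnWalk-reach : ∀ a b → Reach G a b → OnWalk a → OnWalk b
  OnWalk-reach a .a here i = i
  OnWalk-reach a b (step {v = c} ac r) i = OnWalk-reach c b r (OnWalk-step a c ac i)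

  OnWalk-all : ∀ x → OnWalk x
  OnWalk-all x = OnWalk-reach v₀ x (conn v₀ x) (0 , ≤-trans (s≤s z≤n) 1<L , refl)

  n≤L : n ≤ L
  n≤L = injective⇒≤ {f = pre} pre-inj
    where
    pre : Fin n → Fin L
    pre x = fromℕ< (proj₁ (proj₂ (OnWalk-all x)))
    pre-inj : ∀ {x y} → pre x ≡ pre y → x ≡ y
    pre-inj {x} {y} e = trans (≡sym (proj₂ (proj₂ (OnWalk-all x))))
      (trans (cong walk (trans (≡sym (toℕ-fromℕ< _)) (trans (cong toℕ e) (toℕ-fromℕ< _)))) (proj₂ (proj₂ (OnWalk-all y))))

  L≡n : L ≡ n
  L≡n = ≤-antisym L≤n n≤L

  -- adjacency of C_n on positions (cycAdjD of Defs, before toℕ)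
  cycℕ : ℕ → ℕ → Bool
  cycℕ s t = (suc s ≡ᵇ t) ∨ ((s ≡ᵇ 0) ∧ (suc t ≡ᵇ n))

  L≡sL′ : n ≡ suc L′
  L≡sL′ = trans (≡sym L≡n) eqL

  cycℕ→adj : ∀ s t → T (cycℕ s t) → adj G (walk s) (walk t) ≡ true
  cycℕ→adj s t c with T∨ {suc s ≡ᵇ t} c
  ... | inj₁ e = subst (λ z → adj G (walk s) (walk z) ≡ true) (≡ᵇ⇒≡ (suc s) t e) (walk-adj s)
  ... | inj₂ c′ with T∧ {s ≡ᵇ 0} c′
  ...   | e0 , en with ≡ᵇ⇒≡ s 0 e0 | suc-injective (trans (≡ᵇ⇒≡ (suc t) n en) L≡sL′)
  ...     | refl | refl = subst (λ z → adj G v₀ z ≡ true) (≡sym walk-last) (adj-nb₁ v₀)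

  adj→cycℕ : ∀ s t → s < L → t < L → adj G (walk s) (walk t) ≡ true → T (cycℕ s t ∨ cycℕ t s)
  adj→cycℕ zero t _ t<L a with start-neighbours (walk t) a
  ... | inj₁ q rewrite walk-injective-below t L′ t<L L′<L (trans q (≡sym walk-last)) =
    ∨ˡ _ (∨ʳ (1 ≡ᵇ L′) (∧-intro tt (≡⇒≡ᵇ _ _ (≡sym L≡sL′))))
  ... | inj₂ q rewrite walk-injective-below t 1 t<L 1<L q = ∨ˡ (cycℕ 1 0) (∨ˡ ((0 ≡ᵇ 0) ∧ (2 ≡ᵇ n)) tt)
  adj→cycℕ (suc s) t s<L t<L a with walk-neighbours s (walk t) a
  ... | inj₁ q rewrite walk-injective-below t s t<L (<-trans (n<1+n s) s<L) q =
    ∨ʳ (cycℕ (suc s) s) (∨ˡ _ (≡⇒≡ᵇ (suc s) (suc s) refl))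
  ... | inj₂ q with suc (suc s) ≟ℕ L
  ...   | yes e rewrite walk-injective-below t 0 t<L (≤-trans (s≤s z≤n) 1<L) (trans q (trans (cong walk e) (≡sym walk-closes))) =
    ∨ʳ (cycℕ (suc s) 0) (∨ʳ (1 ≡ᵇ suc s) (∧-intro tt (≡⇒≡ᵇ _ _ (trans e L≡n))))
  ...   | no ne rewrite walk-injective-below t (suc (suc s)) t<L (≤∧≢⇒< s<L ne) q =
    ∨ˡ _ (∨ˡ _ (≡⇒≡ᵇ (suc (suc s)) (suc (suc s)) refl))

  σ : Fin n → V G
  σ u = walk (toℕ u)

  <L : ∀ (u : Fin n) → toℕ u < L
  <L u = subst (toℕ u <_) (≡sym L≡n) (toℕ<n u)

  is-cycle : IsCycle G
  is-cycle = n≥3 , σ , (λ u v eq → toℕ-injective (walk-injective-below (toℕ u) (toℕ v) (<L u) (<L v) eq)) ,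
    λ u v → bool-iff (λ t → adj→cycℕ (toℕ u) (toℕ v) (<L u) (<L v) (T→≡ t)) (back {u} {v})
    where
    back : ∀ {u v : Fin n} → T (cycℕ (toℕ u) (toℕ v) ∨ cycℕ (toℕ v) (toℕ u)) →
           T (adj G (walk (toℕ u)) (walk (toℕ v)))
    back {u} {v} c with T∨ {cycℕ (toℕ u) (toℕ v)} c
    ... | inj₁ c1 = ≡→T (cycℕ→adj (toℕ u) (toℕ v) c1)
    ... | inj₂ c2 = ≡→T (trans (sym G (walk (toℕ u)) (walk (toℕ v))) (cycℕ→adj (toℕ v) (toℕ u) c2))

-- A connected graph on ≥ 3 vertices which is not a cycle has a vertex of degree
-- ≥ 3 or ≤ 1: otherwise every vertex has exactly two neighbours and
-- `TwoRegularIsCycle` applies.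
branch-vertex : ∀ G → Connected G → 3 ≤ order G → ¬ IsCycle G → Σ (V G) λ b → Degrees.Many G b ⊎ Degrees.Few G b
branch-vertex G conn n≥3 ¬cycle with any? (λ b → DegreeDecisions.many? G b ⊎-dec DegreeDecisions.few? G b)
... | yes found = found
... | no none = ⊥-elim (¬cycle (TwoRegularIsCycle.is-cycle G conn n≥3 nb₁ nb₂ nb₁≢nb₂ adj-nb₁ adj-nb₂ only-nb))
  where
  open DegreeDecisions G
  two : ∀ b → Two b
  two b = ¬few→two b (λ few → none (b , inj₂ few))
  nb₁ nb₂ : V G → V G
  nb₁ b = proj₁ (two b)
  nb₂ b = proj₁ (proj₂ (two b))
  nb₁≢nb₂ : ∀ b → ¬ nb₁ b ≡ nb₂ b
  nb₁≢nb₂ b = proj₂ (proj₂ (proj₂ (proj₂ (two b))))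
  adj-nb₁ : ∀ b → adj G b (nb₁ b) ≡ true
  adj-nb₁ b = proj₁ (proj₂ (proj₂ (two b)))
  adj-nb₂ : ∀ b → adj G b (nb₂ b) ≡ true
  adj-nb₂ b = proj₁ (proj₂ (proj₂ (proj₂ (two b))))
  only-nb : ∀ b z → adj G b z ≡ true → z ≡ nb₁ b ⊎ z ≡ nb₂ b
  only-nb b = only-two b (λ many → none (b , inj₁ many)) (two b)

-- Hence every automorphism of a subdivision of G maps original vertices to
-- original vertices: first the branch vertex, then, by connectivity, all of them.
originals-preserved : ∀ G → Connected G → 3 ≤ order G → ¬ IsCycle G → ∀ j F →
  SubdivisionAutomorphisms.SubAut G j F → ∀ a → Σ (V G) λ a′ → F (inj₁ a) ≡ inj₁ a′
originals-preserved G conn n≥3 ¬cycle j F sa a =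
  original-spreads b a (conn b a) (branch-vertex-stays-original F sa b many-or-few)
  where
  open SubdivisionAutomorphisms G j
  open PathImages F sa
  b : V G
  b = proj₁ (branch-vertex G conn n≥3 ¬cycle)
  many-or-few : Degrees.Many G b ⊎ Degrees.Few G b
  many-or-few = proj₂ (branch-vertex G conn n≥3 ¬cycle)

corollary3p3 : (G : Graph) → Connected G → 3 ≤ order G → ¬ IsCycle G →
    (k : ℕ) → .{{_ : NonZero k}} →
    (∣Aut∣ (subdivision G k) ≡ ∣Aut∣ G) ×
    (∀ d d′ → IsDistinguishingNumber G d → IsDistinguishingNumber (subdivision G k) d′ → d′ ≤ d)
corollary3p3 G conn n≥3 ¬cycle (suc j) =
  AutomorphismCounting.correspondence⇒∣Aut∣≡ (aut-correspondence preserved) , D-bound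
  where
  open Correspondence G j
  preserved : ∀ F → SubdivisionAutomorphisms.SubAut G j F → ∀ a → Σ (V G) λ a′ → F (inj₁ a) ≡ inj₁ a′
  preserved = originals-preserved G conn n≥3 ¬cycle j
  D-bound : ∀ d d′ → IsDistinguishingNumber G d → IsDistinguishingNumber H d′ → d′ ≤ d
  D-bound d d′ ((c , c-dist) , _) (_ , D-least) =
    D-least d (extend-distinguishing preserved d c c-dist (fromℕ< (≤-trans (s≤s z≤n) n≥3)))
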